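{- Let $p$ be a prime and let $x_1,\dots,x_n$ be positive integers with $\frac{1}{x_1}+\dots+\frac{1}{x_n}=1$, with $p$ dividing at least one $x_i$. Let $\alpha=\max_i v_p(x_i)$ and suppose the indices $i$ with $v_p(x_i)=\alpha$ are exactly $i_1,\dots,i_s$ with $s\geq 2$; write $x_{i_t}=p^{\alpha}x'_{i_t}$ with $p\nmid x'_{i_t}$ for $t=1,\dots,s$. Assume $s<n$ and set $M=\max_{j\notin\{i_1,\dots,i_s\}}v_p(x_j)$. Then $M<\alpha$ and $$p^{\alpha-M}\ \big|\ \sigma_{s-1}(x'_{i_1},\dots,x'_{i_s}).$$ Moreover, if the maximum $M$ is attained at exactly one index $j\notin\{i_1,\dots,i_s\}$ and $M>0$, then $v_p\big(\sigma_{s-1}(x'_{i_1},\dots,x'_{i_s})\big)=\alpha-M$.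
   Context: $v_p$ is the $p$-adic valuation. $\sigma_k(a_1,\dots,a_m)=\sum_{1\leq j_1<\dots<j_k\leq m}a_{j_1}\cdots a_{j_k}$ denotes the $k$-th elementary symmetric function. -}

module Defs where

open import Data.Nat using (ℕ; zero; suc; _⊔_)
open import Data.Nat.Divisibility using (_∣?_; divides)
open import Data.Fin using (Fin)
open import Data.List using (List; []; _∷_; foldr; map; filter; length)
open import Data.List.Base using (allFin)
open import Data.Rational using (ℚ; 0ℚ; _+_; _/_)
open import Data.Integer using (+_)
open import Relation.Nullary using (yes; no; ¬?)
open import Relation.Binary.PropositionalEquality using (_≡_)
open import Data.Nat using (_≟_)

vpAux : ℕ → ℕ → ℕ → ℕ
vpAux zero    p x = 0
vpAux (suc k) p x with p ∣? x
... | yes (divides q _) = suc (vpAux k p q)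
... | no _ = 0

-- v_p(x) for a prime p and x > 0 (fuel x suffices since p^v ≤ x).
-- Junk value v_p(0) = 0; only used for positive x.
vp : ℕ → ℕ → ℕ
vp p x = vpAux x p x

σ : ℕ → List ℕ → ℕ
σ zero    _        = 1
σ (suc k) []       = 0
σ (suc k) (a ∷ as) = a Data.Nat.* σ k as Data.Nat.+ σ (suc k) as

maxL : List ℕ → ℕ
maxL = foldr _⊔_ 0

recip : ℕ → ℚ
recip zero    = 0ℚ
recip (suc k) = + 1 / suc k

sumℚ : ∀ {n} → (Fin n → ℚ) → ℚ
sumℚ {zero}  f = 0ℚ
sumℚ {suc n} f = f Data.Fin.zero + sumℚ (λ i → f (Data.Fin.suc i))

alpha : ∀ {n} → ℕ → (Fin n → ℕ) → ℕ
alpha p x = maxL (map (λ i → vp p (x i)) (allFin _))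

topIdx : ∀ {n} → ℕ → (Fin n → ℕ) → List (Fin n)
topIdx p x = filter (λ i → vp p (x i) ≟ alpha p x) (allFin _)

restIdx : ∀ {n} → ℕ → (Fin n → ℕ) → List (Fin n)
restIdx p x = filter (λ i → ¬? (vp p (x i) ≟ alpha p x)) (allFin _)

bigM : ∀ {n} → ℕ → (Fin n → ℕ) → ℕ
bigM p x = maxL (map (λ j → vp p (x j)) (restIdx p x))

-- Split the indices into the top ones T, where v_p(xᵢ) = α, and the rest R. Clearing
-- denominators in Σ 1/xᵢ = 1 gives σ(x_T) ∏x_R + σ(x_R) ∏x_T = ∏x_T ∏x_R, with σ = σ_{|·|-1}.
-- Substituting x_t = p^α x′_t and x_r = p^{v_r} y_r (p ∤ y_r) and cancelling powers of p, this
-- becomes  S Q + p^(α-M) P′ K = p^(α-M) P′ p^M Q,  where S = σ_{s-1}(x′), P′ = ∏x′, Q = ∏y_r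
-- and K = Σ_r p^(M-v_r) ∏_{r′≠r} y_{r′}. As p ∤ Q, p^(α-M) divides S. If M is attained only
-- once then p ∤ K, since every other summand of K carries a factor p; if moreover M > 0, the
-- right-hand side is divisible by p, so S / p^(α-M) is prime to p.

{-# OPTIONS --safe #-}
module Submission where

open import Defs
open import Data.Nat as ℕ
  using (ℕ; zero; suc; _+_; _*_; _^_; _∸_; _<_; _≤_; _≟_; s≤s; z≤n; z<s; s≤s⁻¹;
         NonZero; ≢-nonZero; >-nonZero⁻¹)
open import Data.Nat.Properties
open import Data.Nat.Divisibility
open import Data.Nat.Primality using (Prime; euclidsLemma; prime⇒nonZero; prime⇒nonTrivial)
open import Data.Nat.ListAction using (product; sum)
import Data.Nat.Tactic.RingSolver as ℕ-Solver
open import Data.Fin as Fin using (Fin)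
open import Data.List using (List; []; _∷_; map; length; filter; foldr; tabulate)
open import Data.List.Base using (allFin)
open import Data.List.Properties
  using (map-tabulate; length-map; map-cong-local; map-∘; filter-some; filter-accept; filter-reject)
open import Data.List.Relation.Unary.All as All using (All; []; _∷_)
open import Data.List.Membership.Propositional using (_∈_)
open import Data.List.Membership.Propositional.Properties using (∈-allFin)
open import Data.List.Relation.Unary.All.Properties using (¬Any⇒All¬; map⁺; map⁻; all-filter)
open import Data.Integer as ℤ using (+_)
import Data.Integer.Properties as ℤ
import Data.Integer.GCD as ℤ
open import Data.Integer.Tactic.RingSolver using (solve-∀)
open import Data.Rational as ℚ using (ℚ; 0ℚ; 1ℚ)
import Data.Rational.Properties as ℚ
open import Data.Rational.Unnormalised as ℚᵘ using (ℚᵘ; mkℚᵘ; *≡*; ↥_; ↧_)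
open import Data.Product using (∃; _×_; _,_; proj₁; proj₂; uncurry)
open import Data.Sum using (inj₁; inj₂)
open import Algebra.Bundles using (CommutativeMonoid)
import Algebra.Properties.CommutativeSemigroup as CommSemigroupProperties
open import Function using (_∘_; id)
open import Level using (0ℓ)
open import Relation.Nullary using (¬_; ¬?; yes; no; contradiction)
open import Relation.Unary using (Pred; Decidable)
open import Relation.Binary.PropositionalEquality
open ≡-Reasoning

module ℤ-* = CommSemigroupProperties ℤ.*-commutativeSemigroup
module ℚ-+ = CommSemigroupProperties (CommutativeMonoid.commutativeSemigroup ℚ.+-0-commutativeMonoid)

-- σ_{n-1}(a₁,…,aₙ) = Σᵢ ∏_{j≠i} aⱼ
cofactorSum : List ℕ → ℕ
cofactorSum []       = 0
cofactorSum (a ∷ as) = product as + a * cofactorSum as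

σ-vanishes : ∀ {k} as → length as < k → σ k as ≡ 0
σ-vanishes {suc k} []       _ = refl
σ-vanishes {suc k} (a ∷ as) (s≤s |as|<k)
  rewrite σ-vanishes as |as|<k | σ-vanishes as (m<n⇒m<1+n |as|<k) | *-zeroʳ a = refl

σ-length≡product : ∀ as → σ (length as) as ≡ product as
σ-length≡product []       = refl
σ-length≡product (a ∷ as)
  rewrite σ-length≡product as | σ-vanishes as (n<1+n (length as)) = +-identityʳ _

σ-length∸1≡cofactorSum : ∀ as → 1 ≤ length as → σ (length as ∸ 1) as ≡ cofactorSum as
σ-length∸1≡cofactorSum (a ∷ [])     _ = cong suc (sym (*-zeroʳ a))
σ-length∸1≡cofactorSum (a ∷ b ∷ bs) _
  rewrite σ-length∸1≡cofactorSum (b ∷ bs) (s≤s z≤n) | σ-length≡product (b ∷ bs) =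
  +-comm (a * cofactorSum (b ∷ bs)) _

product-map-* : ∀ c as → product (map (c *_) as) ≡ c ^ length as * product as
product-map-* c []       = refl
product-map-* c (a ∷ as) rewrite product-map-* c as = swap c a (c ^ length as) (product as)
  where
  swap : ∀ c a e P → c * a * (e * P) ≡ c * e * (a * P)
  swap = ℕ-Solver.solve-∀

*-cofactorSum-map-* : ∀ c as → c * cofactorSum (map (c *_) as) ≡ c ^ length as * cofactorSum as
*-cofactorSum-map-* c []       = *-zeroʳ c
*-cofactorSum-map-* c (a ∷ as) = begin
  c * (product cas + c * a * cofactorSum cas)
    ≡⟨ distribute c a (product cas) (cofactorSum cas) ⟩
  c * product cas + c * a * (c * cofactorSum cas)
    ≡⟨ cong₂ (λ P C → c * P + c * a * C) (product-map-* c as) (*-cofactorSum-map-* c as) ⟩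
  c * (cⁿ * product as) + c * a * (cⁿ * cofactorSum as)
    ≡⟨ collect c a cⁿ (product as) (cofactorSum as) ⟩
  c * cⁿ * (product as + a * cofactorSum as) ∎
  where
  cas = map (c *_) as
  cⁿ = c ^ length as
  distribute : ∀ c a P C → c * (P + c * a * C) ≡ c * P + c * a * (c * C)
  distribute = ℕ-Solver.solve-∀
  collect : ∀ c a e P C → c * (e * P) + c * a * (e * C) ≡ c * e * (P + a * C)
  collect = ℕ-Solver.solve-∀

-- r ≋ m / d states r = m/d, cross-multiplied so that d = 0 needs no special case.
record _≋_/_ (r : ℚᵘ) (m d : ℕ) : Set where
  constructor cross
  field cross-multiplied : ↥ r ℤ.* + d ≡ + m ℤ.* ↧ r

≋-respˡ-≃ : ∀ {r s m d} → r ℚᵘ.≃ s → s ≋ m / d → r ≋ m / d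
≋-respˡ-≃ {r} {s} {m} {d} (*≡* r≃s) (cross s≋m/d) =
  cross (ℤ.*-cancelʳ-≡ _ _ (↧ s) (transport (↥ r) (↧ r) (↥ s) (↧ s) (+ m) (+ d) r≃s s≋m/d))
  where
  open ℤ-*
  transport : ∀ a b c e m d → a ℤ.* e ≡ c ℤ.* b → c ℤ.* d ≡ m ℤ.* e → a ℤ.* d ℤ.* e ≡ m ℤ.* b ℤ.* e
  transport a b c e m d ae≡cb cd≡me = begin
    a ℤ.* d ℤ.* e   ≡⟨ xy∙z≈y∙xz a d e ⟩
    d ℤ.* (a ℤ.* e) ≡⟨ cong (d ℤ.*_) ae≡cb ⟩
    d ℤ.* (c ℤ.* b) ≡⟨ x∙yz≈yx∙z d c b ⟩
    c ℤ.* d ℤ.* b   ≡⟨ cong (ℤ._* b) cd≡me ⟩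
    m ℤ.* e ℤ.* b   ≡⟨ xy∙z≈xz∙y m e b ⟩
    m ℤ.* b ℤ.* e   ∎

+-≋ : ∀ {r s m d m′ d′} → r ≋ m / d → s ≋ m′ / d′ → (r ℚᵘ.+ s) ≋ (m * d′ + m′ * d) / (d * d′)
+-≋ {r@(mkℚᵘ _ _)} {s@(mkℚᵘ _ _)} {m} {d} {m′} {d′} (cross r≋) (cross s≋) = cross (begin
  (↥ r ℤ.* ↧ s ℤ.+ ↥ s ℤ.* ↧ r) ℤ.* + (d * d′)
    ≡⟨ cong ((↥ r ℤ.* ↧ s ℤ.+ ↥ s ℤ.* ↧ r) ℤ.*_) (ℤ.pos-* d d′) ⟩
  (↥ r ℤ.* ↧ s ℤ.+ ↥ s ℤ.* ↧ r) ℤ.* (+ d ℤ.* + d′)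
    ≡⟨ expand (↥ r) (↧ r) (↥ s) (↧ s) (+ d) (+ d′) ⟩
  ↥ r ℤ.* + d ℤ.* (↧ s ℤ.* + d′) ℤ.+ ↥ s ℤ.* + d′ ℤ.* (↧ r ℤ.* + d)
    ≡⟨ cong₂ (λ u w → u ℤ.* (↧ s ℤ.* + d′) ℤ.+ w ℤ.* (↧ r ℤ.* + d)) r≋ s≋ ⟩
  + m ℤ.* ↧ r ℤ.* (↧ s ℤ.* + d′) ℤ.+ + m′ ℤ.* ↧ s ℤ.* (↧ r ℤ.* + d)
    ≡⟨ collect (+ m) (↧ r) (↧ s) (+ d′) (+ m′) (+ d) ⟩
  (+ m ℤ.* + d′ ℤ.+ + m′ ℤ.* + d) ℤ.* (↧ r ℤ.* ↧ s)
    ≡⟨ cong (ℤ._* (↧ r ℤ.* ↧ s)) (sym (trans (ℤ.pos-+ (m * d′) (m′ * d)) (cong₂ ℤ._+_ (ℤ.pos-* m d′) (ℤ.pos-* m′ d)))) ⟩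
  + (m * d′ + m′ * d) ℤ.* ↧ (r ℚᵘ.+ s) ∎)
  where
  expand : ∀ a b c e f g →
    (a ℤ.* e ℤ.+ c ℤ.* b) ℤ.* (f ℤ.* g) ≡ a ℤ.* f ℤ.* (e ℤ.* g) ℤ.+ c ℤ.* g ℤ.* (b ℤ.* f)
  expand = solve-∀
  collect : ∀ a b e f g h →
    a ℤ.* b ℤ.* (e ℤ.* f) ℤ.+ g ℤ.* e ℤ.* (b ℤ.* h) ≡ (a ℤ.* f ℤ.+ g ℤ.* h) ℤ.* (b ℤ.* e)
  collect = solve-∀

recip-≋ : ∀ {a} → 0 < a → ℚ.toℚᵘ (recip a) ≋ 1 / a
recip-≋ {suc k} _ = cross (begin
  ↥ ℚ.toℚᵘ q ℤ.* + suc k  ≡⟨ cong (ℤ._* + suc k) (ℚ.↥ᵘ-toℚᵘ q) ⟩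
  ℚ.↥ q ℤ.* + suc k       ≡⟨ cong (ℚ.↥ q ℤ.*_) (sym (ℚ.↧-/ (+ 1) (suc k))) ⟩
  ℚ.↥ q ℤ.* (ℚ.↧ q ℤ.* g) ≡⟨ ℤ-*.x∙yz≈y∙xz (ℚ.↥ q) (ℚ.↧ q) g ⟩
  ℚ.↧ q ℤ.* (ℚ.↥ q ℤ.* g) ≡⟨ cong (ℚ.↧ q ℤ.*_) (ℚ.↥-/ (+ 1) (suc k)) ⟩
  ℚ.↧ q ℤ.* + 1           ≡⟨ ℤ.*-comm (ℚ.↧ q) (+ 1) ⟩
  + 1 ℤ.* ℚ.↧ q           ≡⟨ cong (+ 1 ℤ.*_) (sym (ℚ.↧ᵘ-toℚᵘ q)) ⟩
  + 1 ℤ.* ↧ ℚ.toℚᵘ q      ∎)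
  where
  q = + 1 ℚ./ suc k
  g = ℤ.gcd (+ 1) (+ suc k)

sumRecip : List ℕ → ℚ
sumRecip = foldr (λ a r → recip a ℚ.+ r) 0ℚ

sumRecip-≋ : ∀ {as} → All (0 <_) as → ℚ.toℚᵘ (sumRecip as) ≋ cofactorSum as / product as
sumRecip-≋ []                    = cross refl
sumRecip-≋ {a ∷ as} (0<a ∷ 0<as) =
  ≋-respˡ-≃ (ℚ.toℚᵘ-homo-+ (recip a) (sumRecip as))
    (subst (λ m → (ℚ.toℚᵘ (recip a) ℚᵘ.+ ℚ.toℚᵘ (sumRecip as)) ≋ m / (a * product as))
      (numerator (product as) (cofactorSum as))
      (+-≋ (recip-≋ 0<a) (sumRecip-≋ 0<as)))
  where
  numerator : ∀ P C → 1 * P + C * a ≡ P + a * C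
  numerator P C = cong₂ _+_ (*-identityˡ P) (*-comm C a)

sumℚ-recip≡sumRecip-tabulate : ∀ {n} (f : Fin n → ℕ) → sumℚ (λ i → recip (f i)) ≡ sumRecip (tabulate f)
sumℚ-recip≡sumRecip-tabulate {zero}  f = refl
sumℚ-recip≡sumRecip-tabulate {suc n} f =
  cong (recip (f Fin.zero) ℚ.+_) (sumℚ-recip≡sumRecip-tabulate (f ∘ Fin.suc))

sumRecip-partition : ∀ {A : Set} (f : A → ℕ) {P : Pred A 0ℓ} (P? : Decidable P) xs →
  sumRecip (map f xs) ≡ sumRecip (map f (filter P? xs)) ℚ.+ sumRecip (map f (filter (¬? ∘ P?) xs))
sumRecip-partition f P? [] = sym (ℚ.+-identityˡ 0ℚ)
sumRecip-partition f P? (x ∷ xs) with P? x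
... | yes _ = trans (cong (recip (f x) ℚ.+_) (sumRecip-partition f P? xs))
  (sym (ℚ.+-assoc (recip (f x)) _ _))
... | no  _ = trans (cong (recip (f x) ℚ.+_) (sumRecip-partition f P? xs))
  (ℚ-+.x∙yz≈y∙xz (recip (f x)) (sumRecip (map f (filter P? xs))) _)

unit-fraction-split : ∀ {as bs} → All (0 <_) as → All (0 <_) bs → sumRecip as ℚ.+ sumRecip bs ≡ 1ℚ →
  cofactorSum as * product bs + cofactorSum bs * product as ≡ product as * product bs
unit-fraction-split {as} {bs} 0<as 0<bs sum≡1 = ℤ.+-injective (begin
  + N         ≡⟨ ℤ.*-identityʳ (+ N) ⟨
  + N ℤ.* + 1 ≡⟨ _≋_/_.cross-multiplied 1≋N/D ⟨
  + 1 ℤ.* + D ≡⟨ ℤ.*-identityˡ (+ D) ⟩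
  + D         ∎)
  where
  N = cofactorSum as * product bs + cofactorSum bs * product as
  D = product as * product bs
  1≋N/D : ℚ.toℚᵘ 1ℚ ≋ N / D
  1≋N/D = subst (λ r → ℚ.toℚᵘ r ≋ N / D) sum≡1
    (≋-respˡ-≃ (ℚ.toℚᵘ-homo-+ (sumRecip as) (sumRecip bs)) (+-≋ (sumRecip-≋ 0<as) (sumRecip-≋ 0<bs)))

∣m∤n⇒∤m+n : ∀ {d m n} → d ∣ m → d ∤ n → d ∤ m + n
∣m∤n⇒∤m+n d∣m d∤n d∣m+n = d∤n (∣m+n∣m⇒∣n d∣m+n d∣m)

∤m∣n⇒∤m+n : ∀ {d m n} → d ∤ m → d ∣ n → d ∤ m + n
∤m∣n⇒∤m+n {d} {m} {n} d∤m d∣n = ∣m∤n⇒∤m+n d∣n d∤m ∘ subst (d ∣_) (+-comm m n)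

p∣p^k*n : ∀ {p} k n → 0 < k → p ∣ p ^ k * n
p∣p^k*n {p} (suc k) n _ = ∣m⇒∣m*n n (m∣m*n (p ^ k))

module _ {p : ℕ} (p-prime : Prime p) where

  private instance
    p≢0 : NonZero p
    p≢0 = prime⇒nonZero p-prime

  1<p : 1 < p
  1<p = ℕ.nonTrivial⇒n>1 p {{prime⇒nonTrivial p-prime}}

  ∤-* : ∀ {m n} → p ∤ m → p ∤ n → p ∤ m * n
  ∤-* p∤m p∤n p∣mn with euclidsLemma _ _ p-prime p∣mn
  ... | inj₁ p∣m = p∤m p∣m
  ... | inj₂ p∣n = p∤n p∣n

  ∤-product : ∀ {ns} → All (p ∤_) ns → p ∤ product ns
  ∤-product []            = >⇒∤ 1<p
  ∤-product (p∤n ∷ p∤ns) = ∤-* p∤n (∤-product p∤ns)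

  p^k∣m*n⇒p^k∣m : ∀ k {m n} → p ∤ n → p ^ k ∣ m * n → p ^ k ∣ m
  p^k∣m*n⇒p^k∣m zero    _   _ = 1∣ _
  p^k∣m*n⇒p^k∣m (suc k) {m} {n} p∤n p^[1+k]∣mn
    with euclidsLemma m n p-prime (m*n∣⇒m∣ p (p ^ k) p^[1+k]∣mn)
  ... | inj₂ p∣n                = contradiction p∣n p∤n
  ... | inj₁ (divides m′ refl) = subst (p ^ suc k ∣_) (*-comm p m′) (*-monoʳ-∣ p p^k∣m′)
    where
    p^k∣m′ : p ^ k ∣ m′
    p^k∣m′ = p^k∣m*n⇒p^k∣m k p∤n (*-cancelˡ-∣ p (subst (p * p ^ k ∣_) (regroup m′ p n) p^[1+k]∣mn))
      where
      regroup : ∀ a p n → a * p * n ≡ p * (a * n)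
      regroup = ℕ-Solver.solve-∀

  vpAux-factorisation : ∀ fuel {x} → 0 < x → x ≤ fuel → ∃ λ y → x ≡ p ^ vpAux fuel p x * y × p ∤ y
  vpAux-factorisation zero       0<x x≤0 = contradiction x≤0 (<⇒≱ 0<x)
  vpAux-factorisation (suc fuel) {x} 0<x x≤1+fuel with p ∣? x
  ... | no p∤x = x , sym (*-identityˡ x) , p∤x
  ... | yes (divides q x≡q*p) with vpAux-factorisation fuel 0<q (s≤s⁻¹ (<-≤-trans q<x x≤1+fuel))
    where
    q≢0 : NonZero q
    q≢0 = ≢-nonZero λ { refl → <⇒≢ 0<x (sym x≡q*p) }
    0<q : 0 < q
    0<q = >-nonZero⁻¹ q {{q≢0}}
    q<x : q < x
    q<x = <-≤-trans (m<m*n q p {{q≢0}} 1<p) (≤-reflexive (sym x≡q*p))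
  ... | y , q≡p^v*y , p∤y = y , (begin
    x                    ≡⟨ x≡q*p ⟩
    q * p                ≡⟨ cong (_* p) q≡p^v*y ⟩
    p ^ v * y * p        ≡⟨ *-comm (p ^ v * y) p ⟩
    p * (p ^ v * y)      ≡⟨ *-assoc p (p ^ v) y ⟨
    p * p ^ v * y        ∎) , p∤y
    where v = vpAux fuel p q

  vp-factorisation : ∀ {x} → 0 < x → ∃ λ y → x ≡ p ^ vp p x * y × p ∤ y
  vp-factorisation {x} 0<x = vpAux-factorisation x 0<x ≤-refl

  p^a*m≡p^b*n⇒a≡b : ∀ a b {m n} → p ^ a * m ≡ p ^ b * n → p ∤ m → p ∤ n → a ≡ b
  p^a*m≡p^b*n⇒a≡b zero    zero    _ _ _ = refl
  p^a*m≡p^b*n⇒a≡b zero    (suc b) {m} {n} eq p∤m _ =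
    contradiction (subst (p ∣_) (trans (sym eq) (*-identityˡ m)) (p∣p^k*n (suc b) n z<s)) p∤m
  p^a*m≡p^b*n⇒a≡b (suc a) zero    {m} {n} eq _ p∤n =
    contradiction (subst (p ∣_) (trans eq (*-identityˡ n)) (p∣p^k*n (suc a) m z<s)) p∤n
  p^a*m≡p^b*n⇒a≡b (suc a) (suc b) {m} {n} eq p∤m p∤n = cong suc (p^a*m≡p^b*n⇒a≡b a b
    (*-cancelˡ-≡ _ _ p (trans (sym (*-assoc p (p ^ a) m)) (trans eq (*-assoc p (p ^ b) n)))) p∤m p∤n)

  vp-p^k*m : ∀ k {m} → p ∤ m → vp p (p ^ k * m) ≡ k
  vp-p^k*m k {m} p∤m with vp-factorisation 0<p^k*m
    where
    0<p^k*m : 0 < p ^ k * m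
    0<p^k*m = >-nonZero⁻¹ (p ^ k * m) {{m*n≢0 (p ^ k) m {{m^n≢0 p k}} {{m≢0}}}}
      where
      m≢0 : NonZero m
      m≢0 = ≢-nonZero λ { refl → p∤m (p ∣0) }
  ... | y , eq , p∤y = p^a*m≡p^b*n⇒a≡b _ k (sym eq) p∤y p∤m

  p∣x⇒0<vp : ∀ {x} → 0 < x → p ∣ x → 0 < vp p x
  p∣x⇒0<vp {x} 0<x p∣x with vp-factorisation 0<x
  ... | y , eq , p∤y with vp p x
  ...   | zero  = contradiction (subst (p ∣_) (trans eq (*-identityˡ y)) p∣x) p∤y
  ...   | suc _ = z<s

  p^k∣-of-balance : ∀ k {S Q P K m} → S * Q + p ^ k * P * K ≡ p ^ k * P * m * Q → p ∤ Q → p ^ k ∣ S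
  p^k∣-of-balance k {S} {Q} {P} {K} {m} balance p∤Q = p^k∣m*n⇒p^k∣m k p∤Q
    (∣m+n∣m⇒∣n (subst (p ^ k ∣_) (trans (sym balance) (+-comm (S * Q) _)) p^k∣RHS) p^k∣p^k*P*K)
    where
    p^k∣RHS : p ^ k ∣ p ^ k * P * m * Q
    p^k∣RHS = ∣m⇒∣m*n Q (∣m⇒∣m*n m (m∣m*n P))
    p^k∣p^k*P*K : p ^ k ∣ p ^ k * P * K
    p^k∣p^k*P*K = ∣m⇒∣m*n K (m∣m*n P)

  vp-of-balance : ∀ k {S Q P K m} → S * Q + p ^ k * P * K ≡ p ^ k * P * m * Q →
    p ∤ Q → p ∤ P → p ∤ K → p ∣ m → vp p S ≡ k
  vp-of-balance k {S} {Q} {P} {K} {m} balance p∤Q p∤P p∤K p∣m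
    with p^k∣-of-balance k {S} {Q} {P} {K} {m} balance p∤Q
  ... | divides S′ refl = trans (cong (vp p) (*-comm S′ (p ^ k))) (vp-p^k*m k p∤S′)
    where
    instance
      p^k≢0 : NonZero (p ^ k)
      p^k≢0 = m^n≢0 p k
    reduced : S′ * Q + P * K ≡ P * m * Q
    reduced = *-cancelˡ-≡ _ _ (p ^ k) (begin
      p ^ k * (S′ * Q + P * K)       ≡⟨ expand (p ^ k) S′ Q P K ⟩
      S′ * p ^ k * Q + p ^ k * P * K ≡⟨ balance ⟩
      p ^ k * P * m * Q              ≡⟨ regroup (p ^ k) P m Q ⟩
      p ^ k * (P * m * Q)            ∎)
      where
      expand : ∀ c S Q P K → c * (S * Q + P * K) ≡ S * c * Q + c * P * K
      expand = ℕ-Solver.solve-∀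
      regroup : ∀ c P m Q → c * P * m * Q ≡ c * (P * m * Q)
      regroup = ℕ-Solver.solve-∀
    p∤S′ : p ∤ S′
    p∤S′ p∣S′ = ∤-* p∤P p∤K
      (∣m+n∣m⇒∣n (subst (p ∣_) (sym reduced) (∣m⇒∣m*n Q (∣n⇒∣m*n P p∣m))) (∣m⇒∣m*n Q p∣S′))

module _ {I : Set} (p M : ℕ) (v y : I → ℕ) where

  -- Σᵢ p^(M - vᵢ) ∏_{j≠i} yⱼ
  reducedCofactorSum : List I → ℕ
  reducedCofactorSum []       = 0
  reducedCofactorSum (i ∷ is) = p ^ (M ∸ v i) * product (map y is) + y i * reducedCofactorSum is

  module _ {x : I → ℕ} (x≡p^v*y : ∀ i → x i ≡ p ^ v i * y i) where

    product-map-p^v*y : ∀ is → product (map x is) ≡ p ^ sum (map v is) * product (map y is)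
    product-map-p^v*y []       = refl
    product-map-p^v*y (i ∷ is) = begin
      x i * product (map x is)
        ≡⟨ cong₂ _*_ (x≡p^v*y i) (product-map-p^v*y is) ⟩
      p ^ v i * y i * (p ^ sum (map v is) * product (map y is))
        ≡⟨ interchange (p ^ v i) (y i) _ _ ⟩
      p ^ v i * p ^ sum (map v is) * (y i * product (map y is))
        ≡⟨ cong (_* (y i * product (map y is))) (^-distribˡ-+-* p (v i) _) ⟨
      p ^ (v i + sum (map v is)) * (y i * product (map y is)) ∎
      where
      interchange : ∀ a b c d → a * b * (c * d) ≡ a * c * (b * d)
      interchange = ℕ-Solver.solve-∀

    p^M*cofactorSum : ∀ is → All (λ i → v i ≤ M) is →
      p ^ M * cofactorSum (map x is) ≡ p ^ sum (map v is) * reducedCofactorSum is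
    p^M*cofactorSum []       []             = *-zeroʳ (p ^ M)
    p^M*cofactorSum (i ∷ is) (vᵢ≤M ∷ vs≤M) = begin
      p ^ M * (product (map x is) + x i * cofactorSum (map x is))
        ≡⟨ distribute (p ^ M) _ (x i) _ ⟩
      p ^ M * product (map x is) + x i * (p ^ M * cofactorSum (map x is))
        ≡⟨ cong₂ (λ P C → p ^ M * P + x i * C) (product-map-p^v*y is) (p^M*cofactorSum is vs≤M) ⟩
      p ^ M * (pⱽ * Y) + x i * (pⱽ * R)
        ≡⟨ cong₂ (λ a b → a * (pⱽ * Y) + b * (pⱽ * R)) p^M≡p^vᵢ*p^[M∸vᵢ] (x≡p^v*y i) ⟩
      p ^ v i * p ^ (M ∸ v i) * (pⱽ * Y) + p ^ v i * y i * (pⱽ * R)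
        ≡⟨ collect (p ^ v i) (p ^ (M ∸ v i)) pⱽ Y (y i) R ⟩
      p ^ v i * pⱽ * (p ^ (M ∸ v i) * Y + y i * R)
        ≡⟨ cong (_* (p ^ (M ∸ v i) * Y + y i * R)) (^-distribˡ-+-* p (v i) (sum (map v is))) ⟨
      p ^ (v i + sum (map v is)) * (p ^ (M ∸ v i) * Y + y i * R) ∎
      where
      pⱽ = p ^ sum (map v is)
      Y  = product (map y is)
      R  = reducedCofactorSum is
      p^M≡p^vᵢ*p^[M∸vᵢ] : p ^ M ≡ p ^ v i * p ^ (M ∸ v i)
      p^M≡p^vᵢ*p^[M∸vᵢ] = trans (cong (p ^_) (sym (m+[n∸m]≡n vᵢ≤M))) (^-distribˡ-+-* p (v i) (M ∸ v i))
      distribute : ∀ c P a C → c * (P + a * C) ≡ c * P + a * (c * C)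
      distribute = ℕ-Solver.solve-∀
      collect : ∀ a b e Y c R → a * b * (e * Y) + a * c * (e * R) ≡ a * e * (b * Y + c * R)
      collect = ℕ-Solver.solve-∀

  p∣reducedCofactorSum : ∀ is → All (λ i → v i < M) is → p ∣ reducedCofactorSum is
  p∣reducedCofactorSum []       []             = p ∣0
  p∣reducedCofactorSum (i ∷ is) (vᵢ<M ∷ vs<M) =
    ∣m∣n⇒∣m+n (p∣p^k*n (M ∸ v i) _ (m<n⇒0<n∸m vᵢ<M)) (∣n⇒∣m*n (y i) (p∣reducedCofactorSum is vs<M))

  below-max : ∀ {is} → All (λ i → v i ≤ M) is → length (filter (λ i → v i ≟ M) is) ≡ 0 →
    All (λ i → v i < M) is
  below-max {is} vs≤M none = All.zipWith (uncurry ≤∧≢⇒<)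
    (vs≤M , ¬Any⇒All¬ is λ some-max → <⇒≢ (filter-some (λ i → v i ≟ M) some-max) (sym none))

  p∤reducedCofactorSum : Prime p → ∀ is → All (λ i → p ∤ y i) is → All (λ i → v i ≤ M) is →
    length (filter (λ i → v i ≟ M) is) ≡ 1 → p ∤ reducedCofactorSum is
  p∤reducedCofactorSum p-prime (i ∷ is) (p∤yᵢ ∷ p∤ys) (vᵢ≤M ∷ vs≤M) one with v i ≟ M
  ... | yes vᵢ≡M =
    ∤m∣n⇒∤m+n p∤pᴹ⁻ᵛⁱY (∣n⇒∣m*n (y i) (p∣reducedCofactorSum is (below-max vs≤M none)))
    where
    none : length (filter (λ i → v i ≟ M) is) ≡ 0
    none = suc-injective (trans (cong length (sym (filter-accept (λ i → v i ≟ M) vᵢ≡M))) one)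
    p∤pᴹ⁻ᵛⁱY : p ∤ p ^ (M ∸ v i) * product (map y is)
    p∤pᴹ⁻ᵛⁱY rewrite vᵢ≡M | n∸n≡0 M | *-identityˡ (product (map y is)) = ∤-product p-prime (map⁺ p∤ys)
  ... | no vᵢ≢M = ∣m∤n⇒∤m+n (p∣p^k*n (M ∸ v i) _ (m<n⇒0<n∸m (≤∧≢⇒< vᵢ≤M vᵢ≢M)))
    (∤-* p-prime p∤yᵢ (p∤reducedCofactorSum p-prime is p∤ys vs≤M
      (trans (cong length (sym (filter-reject (λ i → v i ≟ M) vᵢ≢M))) one)))

top-balance : ∀ c ys {PR CR} .{{_ : NonZero c}} →
  cofactorSum (map (c *_) ys) * PR + CR * product (map (c *_) ys) ≡ product (map (c *_) ys) * PR →
  cofactorSum ys * PR + c * product ys * CR ≡ c * product ys * PR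
top-balance c ys {PR} {CR} split = *-cancelˡ-≡ _ _ (c ^ length ys) {{m^n≢0 c (length ys)}} (begin
  cˢ * (S * PR + c * P * CR)
    ≡⟨ expand cˢ S PR c P CR ⟩
  cˢ * S * PR + c * CR * (cˢ * P)
    ≡⟨ cong₂ (λ u w → u * PR + c * CR * w) (*-cofactorSum-map-* c ys) (product-map-* c ys) ⟨
  c * cofactorSum cys * PR + c * CR * product cys
    ≡⟨ factor c (cofactorSum cys) PR CR (product cys) ⟩
  c * (cofactorSum cys * PR + CR * product cys)
    ≡⟨ cong (c *_) split ⟩
  c * (product cys * PR)
    ≡⟨ cong (λ u → c * (u * PR)) (product-map-* c ys) ⟩
  c * (cˢ * P * PR)
    ≡⟨ swap c cˢ P PR ⟩
  cˢ * (c * P * PR) ∎)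
  where
  cys = map (c *_) ys
  cˢ  = c ^ length ys
  S   = cofactorSum ys
  P   = product ys
  expand : ∀ e S PR c P CR → e * (S * PR + c * P * CR) ≡ e * S * PR + c * CR * (e * P)
  expand = ℕ-Solver.solve-∀
  factor : ∀ c S PR CR P → c * S * PR + c * CR * P ≡ c * (S * PR + CR * P)
  factor = ℕ-Solver.solve-∀
  swap : ∀ c e P PR → c * (e * P * PR) ≡ e * (c * P * PR)
  swap = ℕ-Solver.solve-∀

rest-balance : ∀ {S PR CR P D m e Q K} .{{_ : NonZero m}} .{{_ : NonZero e}} →
  S * PR + D * m * P * CR ≡ D * m * P * PR → PR ≡ e * Q → m * CR ≡ e * K →
  S * Q + D * P * K ≡ D * P * m * Q
rest-balance {S} {PR} {CR} {P} {D} {m} {e} {Q} {K} balance refl m*CR≡e*K =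
  *-cancelˡ-≡ _ _ (m * e) {{m*n≢0 m e}} (begin
    m * e * (S * Q + D * P * K)
      ≡⟨ expand S P Q K e m D ⟩
    m * (S * (e * Q)) + D * P * m * (e * K)
      ≡⟨ cong (λ u → m * (S * (e * Q)) + D * P * m * u) m*CR≡e*K ⟨
    m * (S * (e * Q)) + D * P * m * (m * CR)
      ≡⟨ factor S CR P Q e m D ⟩
    m * (S * (e * Q) + D * m * P * CR)
      ≡⟨ cong (m *_) balance ⟩
    m * (D * m * P * (e * Q))
      ≡⟨ swap P Q e m D ⟩
    m * e * (D * P * m * Q) ∎)
  where
  expand : ∀ S P Q K e m D → m * e * (S * Q + D * P * K) ≡ m * (S * (e * Q)) + D * P * m * (e * K)
  expand = ℕ-Solver.solve-∀
  factor : ∀ S CR P Q e m D → m * (S * (e * Q)) + D * P * m * (m * CR) ≡ m * (S * (e * Q) + D * m * P * CR)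
  factor = ℕ-Solver.solve-∀
  swap : ∀ P Q e m D → m * (D * m * P * (e * Q)) ≡ m * e * (D * P * m * Q)
  swap = ℕ-Solver.solve-∀

maxL-upper : ∀ ns → All (_≤ maxL ns) ns
maxL-upper []       = []
maxL-upper (n ∷ ns) =
  m≤m⊔n n (maxL ns) ∷ All.map (λ k≤max → ≤-trans k≤max (m≤n⊔m n (maxL ns))) (maxL-upper ns)

maxL< : ∀ {a} ns → 0 < a → All (_< a) ns → maxL ns < a
maxL< []       0<a []            = 0<a
maxL< (n ∷ ns) 0<a (n<a ∷ ns<a) = ⊔-lub n<a (maxL< ns 0<a ns<a)

sumℚ-recip-partition : ∀ {n} (x : Fin n → ℕ) {P : Pred (Fin n) 0ℓ} (P? : Decidable P) →
  sumℚ (λ i → recip (x i))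
    ≡ sumRecip (map x (filter P? (allFin n))) ℚ.+ sumRecip (map x (filter (¬? ∘ P?) (allFin n)))
sumℚ-recip-partition {n} x P? = begin
  sumℚ (λ i → recip (x i))      ≡⟨ sumℚ-recip≡sumRecip-tabulate x ⟩
  sumRecip (tabulate x)         ≡⟨ cong sumRecip (map-tabulate id x) ⟨
  sumRecip (map x (allFin n))   ≡⟨ sumRecip-partition x P? (allFin n) ⟩
  _                             ∎

module _ {p : ℕ} (p-prime : Prime p) {n : ℕ} (x : Fin n → ℕ) (0<x : ∀ i → 0 < x i) where

  vp≤alpha : ∀ i → vp p (x i) ≤ alpha p x
  vp≤alpha i = All.lookup (map⁻ (maxL-upper (map (λ j → vp p (x j)) (allFin n)))) (∈-allFin i)

  restIdx<alpha : All (λ j → vp p (x j) < alpha p x) (restIdx p x)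
  restIdx<alpha = All.map (λ {j} vⱼ≢α → ≤∧≢⇒< (vp≤alpha j) vⱼ≢α)
    (all-filter (λ j → ¬? (vp p (x j) ≟ alpha p x)) (allFin n))

  restIdx≤bigM : All (λ j → vp p (x j) ≤ bigM p x) (restIdx p x)
  restIdx≤bigM = map⁻ (maxL-upper (map (λ j → vp p (x j)) (restIdx p x)))

  bigM<alpha : ∃ (λ i → p ∣ x i) → bigM p x < alpha p x
  bigM<alpha (i , p∣xᵢ) = maxL< (map (λ j → vp p (x j)) (restIdx p x))
    (<-≤-trans (p∣x⇒0<vp p-prime (0<x i) p∣xᵢ) (vp≤alpha i)) (map⁺ restIdx<alpha)

  private
    instance
      p≢0 : NonZero p
      p≢0 = prime⇒nonZero p-prime

    pFree : Fin n → ℕ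
    pFree j = proj₁ (vp-factorisation p-prime (0<x j))

    x≡p^vp*pFree : ∀ j → x j ≡ p ^ vp p (x j) * pFree j
    x≡p^vp*pFree j = proj₁ (proj₂ (vp-factorisation p-prime (0<x j)))

    p∤pFree : ∀ j → p ∤ pFree j
    p∤pFree j = proj₂ (proj₂ (vp-factorisation p-prime (0<x j)))

  module Balance (sum≡1 : sumℚ (λ i → recip (x i)) ≡ 1ℚ) (x′ : Fin n → ℕ)
    (top : ∀ i → i ∈ topIdx p x → (x i ≡ p ^ alpha p x * x′ i) × p ∤ x′ i)
    (M<α : bigM p x < alpha p x) where

    private
      α = alpha p x
      M = bigM p x
      T = topIdx p x
      R = restIdx p x
      v : Fin n → ℕ
      v j = vp p (x j)

    S P′ Q K : ℕ
    S  = cofactorSum (map x′ T)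
    P′ = product (map x′ T)
    Q  = product (map pFree R)
    K  = reducedCofactorSum p M v pFree R

    balance : S * Q + p ^ (α ∸ M) * P′ * K ≡ p ^ (α ∸ M) * P′ * p ^ M * Q
    balance = rest-balance {S = S} {P = P′} {D = p ^ (α ∸ M)}
      {{m^n≢0 p M}} {{m^n≢0 p (sum (map v R))}}
      (subst (λ c → S * PR + c * P′ * CR ≡ c * P′ * PR) p^α≡p^[α∸M]*p^M
        (top-balance (p ^ α) (map x′ T) {{m^n≢0 p α}}
          (subst (λ xs → cofactorSum xs * PR + CR * product xs ≡ product xs * PR) map-x-T split)))
      (product-map-p^v*y p M v pFree x≡p^vp*pFree R)
      (p^M*cofactorSum p M v pFree x≡p^vp*pFree R restIdx≤bigM)
      where
      PR = product (map x R)
      CR = cofactorSum (map x R)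
      split : cofactorSum (map x T) * PR + CR * product (map x T) ≡ product (map x T) * PR
      split = unit-fraction-split (map⁺ (All.universal 0<x T)) (map⁺ (All.universal 0<x R))
        (trans (sym (sumℚ-recip-partition x (λ j → v j ≟ α))) sum≡1)
      map-x-T : map x T ≡ map (p ^ α *_) (map x′ T)
      map-x-T = trans (map-cong-local (All.tabulate (proj₁ ∘ top _))) (map-∘ T)
      p^α≡p^[α∸M]*p^M : p ^ α ≡ p ^ (α ∸ M) * p ^ M
      p^α≡p^[α∸M]*p^M =
        trans (cong (p ^_) (sym (m∸n+n≡m (<⇒≤ M<α)))) (^-distribˡ-+-* p (α ∸ M) M)

    σ≡S : 1 ≤ length T → σ (length T ∸ 1) (map x′ T) ≡ S
    σ≡S 1≤s = begin
      σ (length T ∸ 1) (map x′ T)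
        ≡⟨ cong (λ k → σ (k ∸ 1) (map x′ T)) (length-map x′ T) ⟨
      σ (length (map x′ T) ∸ 1) (map x′ T)
        ≡⟨ σ-length∸1≡cofactorSum (map x′ T) (subst (1 ≤_) (sym (length-map x′ T)) 1≤s) ⟩
      S ∎

    p∤P′ : p ∤ P′
    p∤P′ = ∤-product p-prime (map⁺ (All.tabulate (proj₂ ∘ top _)))

    p∤Q : p ∤ Q
    p∤Q = ∤-product p-prime (map⁺ (All.universal p∤pFree R))

    p∤K : length (filter (λ j → v j ≟ M) R) ≡ 1 → p ∤ K
    p∤K = p∤reducedCofactorSum p M v pFree p-prime R (All.universal p∤pFree R) restIdx≤bigM

    p^[α∸M]∣S : p ^ (α ∸ M) ∣ S
    p^[α∸M]∣S = p^k∣-of-balance p-prime (α ∸ M) {S} {Q} {P′} {K} {p ^ M} balance p∤Q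

    vp[S]≡α∸M : length (filter (λ j → v j ≟ M) R) ≡ 1 → 0 < M → vp p S ≡ α ∸ M
    vp[S]≡α∸M unique 0<M =
      vp-of-balance p-prime (α ∸ M) {S} {Q} {P′} {K} {p ^ M} balance p∤Q p∤P′ (p∤K unique)
        (subst (p ∣_) (*-identityʳ (p ^ M)) (p∣p^k*n M 1 0<M))

corollary3 : (p : ℕ) → Prime p → (n : ℕ) → (x : Fin n → ℕ)
    → (∀ i → 0 < x i)
    → sumℚ (λ i → recip (x i)) ≡ 1ℚ
    → ∃ (λ i → p ∣ x i)
    → 2 ≤ length (topIdx p x)
    → length (topIdx p x) < n
    → (x′ : Fin n → ℕ)
    → (∀ i → i ∈ topIdx p x → (x i ≡ p ^ alpha p x * x′ i) × ¬ (p ∣ x′ i))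
    → (bigM p x < alpha p x)
      × (p ^ (alpha p x ∸ bigM p x) ∣ σ (length (topIdx p x) ∸ 1) (map x′ (topIdx p x)))
      × (length (filter (λ j → vp p (x j) ≟ bigM p x) (restIdx p x)) ≡ 1
         → 0 < bigM p x
         → vp p (σ (length (topIdx p x) ∸ 1) (map x′ (topIdx p x))) ≡ alpha p x ∸ bigM p x)
-- The hypothesis s < n is not used: if every index is a top one, bigM is the junk value 0 < α.
corollary3 p p-prime n x 0<x sum≡1 p∣some 2≤s _ x′ top =
    M<α
  , subst (_ ∣_) (sym (σ≡S 1≤s)) p^[α∸M]∣S
  , λ unique 0<M → trans (cong (vp p) (σ≡S 1≤s)) (vp[S]≡α∸M unique 0<M)
  where
  M<α : bigM p x < alpha p x
  M<α = bigM<alpha p-prime x 0<x p∣some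
  open Balance p-prime x 0<x sum≡1 x′ top M<α
  1≤s : 1 ≤ length (topIdx p x)
  1≤s = ≤-trans (s≤s z≤n) 2≤s
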